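{- Let $G$ be a finite simple graph in which all maximal open packings have the same cardinality. (a) If $G$ has at least one support vertex, then any graph obtained from $G$ by adding a new vertex adjacent only to some support vertex of $G$ also has all maximal open packings of the same cardinality. (b) If $G$ has a strong support vertex $s$ and $w$ is a leaf adjacent to $s$, then $G-w$ also has all maximal open packings of the same cardinality.
   Context: A set $P\subseteq V(G)$ is an open packing if no two distinct vertices of $P$ have a common neighbor; a maximal open packing is one maximal under inclusion. A leaf is a vertex of degree $1$; a support vertex is a vertex adjacent to at least one leaf; a strong support vertex is a vertex adjacent to more than one leaf. -}

module Defs where

open import Data.Nat using (ℕ; suc)
open import Data.Fin using (Fin; zero; suc; punchIn)
open import Data.Fin.Subset using (Subset; _∈_; _∉_; _⊆_; ∣_∣)
open import Data.Product using (Σ; ∃; _×_; _,_)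
open import Data.Empty using (⊥)
open import Relation.Nullary using (¬_)
open import Relation.Binary.PropositionalEquality using (_≡_; _≢_; refl; sym)

record Graph (n : ℕ) : Set₁ where
  field
    Adj    : Fin n → Fin n → Set
    symAdj : ∀ {u v} → Adj u v → Adj v u
    irrAdj : ∀ {v} → ¬ Adj v v
open Graph public

module _ {n : ℕ} (G : Graph n) where

  OpenPacking : Subset n → Set
  OpenPacking P = ∀ u v w → u ∈ P → v ∈ P → u ≢ v → Adj G u w → Adj G v w → ⊥

  MaximalOpenPacking : Subset n → Set
  MaximalOpenPacking P = OpenPacking P × (∀ Q → P ⊆ Q → OpenPacking Q → Q ⊆ P)

  AllMaxOPSameSize : Set
  AllMaxOPSameSize = ∀ P Q → MaximalOpenPacking P → MaximalOpenPacking Q → ∣ P ∣ ≡ ∣ Q ∣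

  Leaf : Fin n → Set
  Leaf v = Σ (Fin n) λ u → Adj G v u × (∀ x → Adj G v x → x ≡ u)

  SupportVertex : Fin n → Set
  SupportVertex s = Σ (Fin n) λ l → Adj G s l × Leaf l

  StrongSupportVertex : Fin n → Set
  StrongSupportVertex s = Σ (Fin n) λ l₁ → Σ (Fin n) λ l₂ →
    l₁ ≢ l₂ × Adj G s l₁ × Leaf l₁ × Adj G s l₂ × Leaf l₂

-- G plus a new vertex (zero) adjacent only to s; old vertex v becomes suc v.
module _ {n : ℕ} (G : Graph n) (s : Fin n) where
  private
    A : Fin (suc n) → Fin (suc n) → Set
    A zero    zero    = ⊥
    A zero    (suc v) = v ≡ s
    A (suc u) zero    = u ≡ s
    A (suc u) (suc v) = Adj G u v

    sA : ∀ {u v} → A u v → A v u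
    sA {zero}  {suc v} p = p
    sA {suc u} {zero}  p = p
    sA {suc u} {suc v} p = symAdj G p

    iA : ∀ {v} → ¬ A v v
    iA {zero}  ()
    iA {suc v} p = irrAdj G p

  addPendant : Graph (suc n)
  addPendant = record { Adj = A ; symAdj = λ {u} {v} → sA {u} {v} ; irrAdj = λ {v} → iA {v} }

-- G - w: the induced subgraph on all vertices except w
-- (vertex i of G - w is vertex punchIn w i of G).
deleteVertex : {m : ℕ} → Graph (suc m) → Fin (suc m) → Graph m
deleteVertex G w = record
  { Adj    = λ u v → Adj G (punchIn w u) (punchIn w v)
  ; symAdj = λ {u} {v} → symAdj G {punchIn w u} {punchIn w v}
  ; irrAdj = λ {v} → irrAdj G {punchIn w v}
  }

module Submission where

-- Both parts of the theorem are instances of one fact about twin leaves: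
-- if x and l are distinct leaves attached to the same vertex s of G, then all
-- maximal open packings of G have the same size iff the same holds for G - x.
--
-- The proof rests on two size-preserving correspondences of maximal open packings.
--   * Lifting: a maximal open packing P of G - x, read in G, is still maximal.
--     (x can never be added, since otherwise l, which is interchangeable with x,
--     could be added to P already in G - x.)
--   * Shrinking: a maximal open packing P of G with x ∉ P restricts to a maximal
--     open packing of G - x; if x ∈ P we first exchange x for its twin l.
-- So each side's maximal open packings are matched, size for size, with some of the
-- other side's, which transfers "all maximal open packings have the same size".
--
-- Part (b) applies it directly; part (a)
-- applies it to G plus a pendant vertex, whose deletion gives back G.

open import Defs
open import Data.Nat using (ℕ; suc)
open import Data.Fin using (Fin; zero; suc; punchIn; punchOut; _≟_)
open import Data.Fin.Properties using (punchInᵢ≢i; punchIn-punchOut; punchOut-punchIn; punchIn-injective)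
open import Data.Fin.Subset using (Subset; _∈_; _∉_; _⊆_; ∣_∣; _-_; _∪_; ⁅_⁆; inside; outside)
open import Data.Fin.Subset.Properties using (_∈?_; x∈p∪q⁻; x∈p∪q⁺; x∈⁅x⁆; x∈⁅y⁆⇒x≡y; p─q⊆p; x∈p∧x≢y⇒x∈p-y; p─⊥≡p; ∪-identityʳ)
open import Data.Vec using (_∷_; here; there; lookup; insertAt; removeAt)
open import Data.Vec.Properties using ([]=⇒lookup; lookup⇒[]=; insertAt-punchIn; insertAt-lookup; removeAt-punchOut; insertAt-removeAt)
open import Data.Product using (Σ; _×_; _,_; proj₁)
open import Data.Sum using (_⊎_; inj₁; inj₂)
open import Data.Empty using (⊥-elim)
open import Relation.Nullary using (yes; no)
open import Relation.Binary.PropositionalEquality using (_≡_; _≢_; refl; sym; trans; cong; subst; module ≡-Reasoning)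
open import Function using (_∘_)

∣p-x∣ : ∀ {n} (p : Subset n) {x} → x ∈ p → suc ∣ p - x ∣ ≡ ∣ p ∣
∣p-x∣ (inside ∷ p)  here      = cong (suc ∘ ∣_∣) (p─⊥≡p p)
∣p-x∣ (inside ∷ p)  (there m) = cong suc (∣p-x∣ p m)
∣p-x∣ (outside ∷ p) (there m) = ∣p-x∣ p m

∣p∪⁅x⁆∣ : ∀ {n} (p : Subset n) {x} → x ∉ p → ∣ p ∪ ⁅ x ⁆ ∣ ≡ suc ∣ p ∣
∣p∪⁅x⁆∣ (inside ∷ p)  {zero}  x∉p = ⊥-elim (x∉p here)
∣p∪⁅x⁆∣ (outside ∷ p) {zero}  _   = cong (suc ∘ ∣_∣) (∪-identityʳ p)
∣p∪⁅x⁆∣ (inside ∷ p)  {suc x} x∉p = cong suc (∣p∪⁅x⁆∣ p (x∉p ∘ there))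
∣p∪⁅x⁆∣ (outside ∷ p) {suc x} x∉p = ∣p∪⁅x⁆∣ p (x∉p ∘ there)

x∉p-x : ∀ {n} (p : Subset n) x → x ∉ p - x
x∉p-x (_ ∷ p) zero    ()
x∉p-x (_ ∷ p) (suc x) (there m) = x∉p-x p x m

replace : ∀ {n} → Subset n → Fin n → Fin n → Subset n
replace P x l = (P - x) ∪ ⁅ l ⁆

module _ {n : ℕ} {P : Subset n} {x l : Fin n} where

  replace-new : l ∈ replace P x l
  replace-new = x∈p∪q⁺ (inj₂ (x∈⁅x⁆ l))

  replace-keep : ∀ {y} → y ∈ P → y ≢ x → y ∈ replace P x l
  replace-keep y∈P y≢x = x∈p∪q⁺ (inj₁ (x∈p∧x≢y⇒x∈p-y y∈P y≢x))

  replace-member : ∀ {y} → y ∈ replace P x l → y ≡ l ⊎ (y ∈ P × y ≢ x)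
  replace-member {y} y∈ with x∈p∪q⁻ (P - x) ⁅ l ⁆ y∈
  ... | inj₁ y∈P-x = inj₂ (p─q⊆p P ⁅ x ⁆ y∈P-x , λ { refl → x∉p-x P x y∈P-x })
  ... | inj₂ y∈⁅l⁆ = inj₁ (x∈⁅y⁆⇒x≡y l y∈⁅l⁆)

  replace-drops : x ≢ l → x ∉ replace P x l
  replace-drops x≢l x∈ with replace-member x∈
  ... | inj₁ x≡l        = x≢l x≡l
  ... | inj₂ (_ , x≢x) = x≢x refl

  ∣replace∣ : x ∈ P → l ∉ P → ∣ replace P x l ∣ ≡ ∣ P ∣
  ∣replace∣ x∈P l∉P = trans (∣p∪⁅x⁆∣ (P - x) (l∉P ∘ p─q⊆p P ⁅ x ⁆)) (∣p-x∣ P x∈P)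

∣insertAt-outside∣ : ∀ {m} (p : Subset m) w → ∣ insertAt p w outside ∣ ≡ ∣ p ∣
∣insertAt-outside∣ p             zero    = refl
∣insertAt-outside∣ (inside ∷ p)  (suc w) = cong suc (∣insertAt-outside∣ p w)
∣insertAt-outside∣ (outside ∷ p) (suc w) = ∣insertAt-outside∣ p w

-- Subsets across the deletion of a vertex w: a subset p of the vertices of G - w
-- is read in G as  insertAt p w outside,  a subset q of G restricts to  removeAt q w.

module _ {m : ℕ} {w : Fin (suc m)} where

  lookup-removeAt : ∀ (q : Subset (suc m)) j → lookup (removeAt q w) j ≡ lookup q (punchIn w j)
  lookup-removeAt q j =
    trans (cong (lookup (removeAt q w)) (sym (punchOut-punchIn w))) (removeAt-punchOut q (punchInᵢ≢i w j ∘ sym))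

  restrict⁺ : ∀ {q j} → punchIn w j ∈ q → j ∈ removeAt q w
  restrict⁺ {q} {j} m = lookup⇒[]= j (removeAt q w) (trans (lookup-removeAt q j) ([]=⇒lookup m))

  restrict⁻ : ∀ {q j} → j ∈ removeAt q w → punchIn w j ∈ q
  restrict⁻ {q} {j} m = lookup⇒[]= (punchIn w j) q (trans (sym (lookup-removeAt q j)) ([]=⇒lookup m))

  embed⁺ : ∀ {p j} → j ∈ p → punchIn w j ∈ insertAt p w outside
  embed⁺ {p} {j} m = lookup⇒[]= (punchIn w j) _ (trans (insertAt-punchIn p w outside j) ([]=⇒lookup m))

  w∉embed : ∀ {p} → w ∉ insertAt p w outside
  w∉embed {p} m with trans (sym (insertAt-lookup p w outside)) ([]=⇒lookup m)
  ... | ()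

  embed⁻ : ∀ {p y} → y ∈ insertAt p w outside → Σ (Fin m) λ j → punchIn w j ≡ y × j ∈ p
  embed⁻ {p} {y} y∈ with w ≟ y
  ... | yes refl = ⊥-elim (w∉embed y∈)
  ... | no w≢y   = punchOut w≢y , punchIn-punchOut w≢y ,
                   lookup⇒[]= _ p (trans (sym (insertAt-punchIn p w outside _))
                                         (trans (cong (lookup (insertAt p w outside)) (punchIn-punchOut w≢y))
                                                ([]=⇒lookup y∈)))

  restrict-embed-⊆ : ∀ {P Q} → w ∉ P → removeAt P w ⊆ Q → P ⊆ insertAt Q w outside
  restrict-embed-⊆ {P} w∉P sub {y} y∈P with w ≟ y
  ... | yes refl = ⊥-elim (w∉P y∈P)
  ... | no w≢y   = subst (_∈ _) (punchIn-punchOut w≢y)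
                     (embed⁺ (sub (restrict⁺ (subst (_∈ P) (sym (punchIn-punchOut w≢y)) y∈P))))

  embed-restrict-⊆ : ∀ {P Q} → insertAt P w outside ⊆ Q → P ⊆ removeAt Q w
  embed-restrict-⊆ sub j∈P = restrict⁺ (sub (embed⁺ j∈P))

  lookup-outside : ∀ {q : Subset (suc m)} → w ∉ q → lookup q w ≡ outside
  lookup-outside {q} w∉q with lookup q w in eq
  ... | outside = refl
  ... | inside  = ⊥-elim (w∉q (lookup⇒[]= w q eq))

  ∣restrict∣ : ∀ {q : Subset (suc m)} → w ∉ q → ∣ removeAt q w ∣ ≡ ∣ q ∣
  ∣restrict∣ {q} w∉q = begin
    ∣ removeAt q w ∣                            ≡⟨ sym (∣insertAt-outside∣ (removeAt q w) w) ⟩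
    ∣ insertAt (removeAt q w) w outside ∣       ≡⟨ cong (λ b → ∣ insertAt (removeAt q w) w b ∣) (sym (lookup-outside w∉q)) ⟩
    ∣ insertAt (removeAt q w) w (lookup q w) ∣  ≡⟨ cong ∣_∣ (insertAt-removeAt q w) ⟩
    ∣ q ∣                                        ∎
    where open ≡-Reasoning

sameSize-transfer : ∀ {m n} (H : Graph m) (G : Graph n) →
  (∀ P → MaximalOpenPacking H P → Σ (Subset n) λ Q → MaximalOpenPacking G Q × ∣ Q ∣ ≡ ∣ P ∣) →
  AllMaxOPSameSize G → AllMaxOPSameSize H
sameSize-transfer H G match same P P′ mP mP′ with match P mP | match P′ mP′
... | Q , mQ , ∣Q∣≡∣P∣ | Q′ , mQ′ , ∣Q′∣≡∣P′∣ = trans (sym ∣Q∣≡∣P∣) (trans (same Q Q′ mQ mQ′) ∣Q′∣≡∣P′∣)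

record TwinLeaves {n : ℕ} (G : Graph n) (x l : Fin n) : Set where
  field
    support  : Fin n
    distinct : x ≢ l
    x-adj    : Adj G x support
    l-adj    : Adj G l support
    x-leaf   : Leaf G x
    l-leaf   : Leaf G l

module _ {n : ℕ} (G : Graph n) where

  leaf-nbrs-equal : ∀ {x y z} → Leaf G x → Adj G x y → Adj G x z → y ≡ z
  leaf-nbrs-equal (_ , _ , only) xy xz = trans (only _ xy) (sym (only _ xz))

  leaves-twins : ∀ {s x l} → Adj G s x → Leaf G x → Adj G s l → Leaf G l → x ≢ l → TwinLeaves G x l
  leaves-twins sx leafx sl leafl x≢l = record
    { support = _ ; distinct = x≢l ; x-adj = symAdj G sx ; l-adj = symAdj G sl ; x-leaf = leafx ; l-leaf = leafl }

  twins-sym : ∀ {x l} → TwinLeaves G x l → TwinLeaves G l x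
  twins-sym t = record { support = support ; distinct = distinct ∘ sym
                       ; x-adj = l-adj ; l-adj = x-adj ; x-leaf = l-leaf ; l-leaf = x-leaf }
    where open TwinLeaves t

  twin-nbr : ∀ {x l z} → TwinLeaves G x l → Adj G l z → Adj G x z
  twin-nbr t lz = subst (Adj G _) (leaf-nbrs-equal l-leaf l-adj lz) x-adj
    where open TwinLeaves t

  twins-exclusive : ∀ {x l Q} → TwinLeaves G x l → OpenPacking G Q → x ∈ Q → l ∉ Q
  twins-exclusive t opQ x∈Q l∈Q = opQ _ _ support x∈Q l∈Q distinct x-adj l-adj
    where open TwinLeaves t

  replace-open : ∀ {P x l} → (∀ {z} → Adj G l z → Adj G x z) → x ∈ P →
                 OpenPacking G P → OpenPacking G (replace P x l)
  replace-open N⊆ x∈P op u v z u∈ v∈ u≢v uz vz with replace-member u∈ | replace-member v∈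
  ... | inj₁ refl          | inj₁ refl          = u≢v refl
  ... | inj₁ refl          | inj₂ (v∈P , v≢x)   = op _ v z x∈P v∈P (v≢x ∘ sym) (N⊆ uz) vz
  ... | inj₂ (u∈P , u≢x)   | inj₁ refl          = op u _ z u∈P x∈P u≢x uz (N⊆ vz)
  ... | inj₂ (u∈P , _)     | inj₂ (v∈P , _)     = op u v z u∈P v∈P u≢v uz vz

  -- Exchanging a twin for the other keeps a packing maximal.  Maximality of the
  -- result is obtained by exchanging back inside any larger open packing.
  replace-maximal : ∀ {P x l} → TwinLeaves G x l → x ∈ P →
                    MaximalOpenPacking G P → MaximalOpenPacking G (replace P x l)
  replace-maximal {P} {x} {l} t x∈P (op , max) = replace-open (twin-nbr t) x∈P op , grow
    where
    grow : ∀ Q → replace P x l ⊆ Q → OpenPacking G Q → Q ⊆ replace P x l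
    grow Q sub opQ {y} y∈Q with l ≟ y
    ... | yes refl = replace-new
    ... | no l≢y   = replace-keep (back (replace-keep y∈Q (l≢y ∘ sym))) (λ { refl → x∉Q y∈Q })
      where
      l∈Q : l ∈ Q
      l∈Q = sub replace-new
      x∉Q : x ∉ Q
      x∉Q x∈Q = twins-exclusive t opQ x∈Q l∈Q
      P⊆back : P ⊆ replace Q l x
      P⊆back {v} v∈P with x ≟ v
      ... | yes refl = replace-new
      ... | no x≢v   = replace-keep (sub (replace-keep v∈P (x≢v ∘ sym)))
                                    (λ { refl → twins-exclusive t op x∈P v∈P })
      back : replace Q l x ⊆ P
      back = max _ P⊆back (replace-open (twin-nbr (twins-sym t)) l∈Q opQ)

module _ {m : ℕ} (G : Graph (suc m)) (w : Fin (suc m)) where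

  private
    H : Graph m
    H = deleteVertex G w

  restrict-open : ∀ {Q} → OpenPacking G Q → OpenPacking H (removeAt Q w)
  restrict-open opQ u v z u∈ v∈ u≢v uz vz =
    opQ _ _ _ (restrict⁻ u∈) (restrict⁻ v∈) (u≢v ∘ punchIn-injective w u v) uz vz

  -- Lifting keeps a packing open when w is a leaf: two vertices adjacent to w coincide.
  embed-open : ∀ {P} → Leaf G w → OpenPacking H P → OpenPacking G (insertAt P w outside)
  embed-open leaf op u v z u∈ v∈ u≢v uz vz with embed⁻ u∈ | embed⁻ v∈
  ... | j , refl , j∈P | k , refl , k∈P with w ≟ z
  ...   | yes refl = u≢v (leaf-nbrs-equal G leaf (symAdj G uz) (symAdj G vz))
  ...   | no w≢z   = op j k (punchOut w≢z) j∈P k∈P (u≢v ∘ cong (punchIn w))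
                        (subst (Adj G (punchIn w j)) (sym (punchIn-punchOut w≢z)) uz)
                        (subst (Adj G (punchIn w k)) (sym (punchIn-punchOut w≢z)) vz)

  restrict-maximal : ∀ {P} → Leaf G w → MaximalOpenPacking G P → w ∉ P →
                     MaximalOpenPacking H (removeAt P w)
  restrict-maximal leaf (op , max) w∉P =
    restrict-open op ,
    λ Q sub opQ j∈Q → restrict⁺ (max _ (restrict-embed-⊆ w∉P sub) (embed-open leaf opQ) (embed⁺ j∈Q))

  -- A maximal open packing of G - w stays maximal in G when w has a twin leaf l:
  -- if a larger open packing Q contained w, exchanging w for l in Q would give,
  -- back in G - w, an open packing containing P and l, so l ∈ P ⊆ Q, impossible.
  embed-maximal : ∀ {P l} → TwinLeaves G w l → MaximalOpenPacking H P →
                  MaximalOpenPacking G (insertAt P w outside)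
  embed-maximal {P} {l} t (op , max) = embed-open x-leaf op , grow
    where
    open TwinLeaves t
    grow : ∀ Q → insertAt P w outside ⊆ Q → OpenPacking G Q → Q ⊆ insertAt P w outside
    grow Q sub opQ = restrict-embed-⊆ w∉Q (max _ (embed-restrict-⊆ sub) (restrict-open opQ))
      where
      w∉Q : w ∉ Q
      w∉Q w∈Q = twins-exclusive G t opQ w∈Q (sub l∈P)
        where
        P⊆S : insertAt P w outside ⊆ replace Q w l
        P⊆S y∈ = replace-keep (sub y∈) (λ { refl → w∉embed y∈ })
        S⊆P : replace Q w l ⊆ insertAt P w outside
        S⊆P = restrict-embed-⊆ (replace-drops distinct)
                (max _ (embed-restrict-⊆ P⊆S) (restrict-open (replace-open G (twin-nbr G t) w∈Q opQ)))
        l∈P : l ∈ insertAt P w outside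
        l∈P = S⊆P replace-new

shrink : ∀ {m} (G : Graph (suc m)) {x l} → TwinLeaves G x l →
         ∀ P → MaximalOpenPacking G P →
         Σ (Subset m) λ Q → MaximalOpenPacking (deleteVertex G x) Q × ∣ Q ∣ ≡ ∣ P ∣
shrink G {x} {l} t P mP@(op , _) with x ∈? P
... | no x∉P  = removeAt P x , restrict-maximal G x x-leaf mP x∉P , ∣restrict∣ x∉P
  where open TwinLeaves t
... | yes x∈P = removeAt (replace P x l) x ,
                restrict-maximal G x x-leaf (replace-maximal G t x∈P mP) x∉S ,
                trans (∣restrict∣ x∉S) (∣replace∣ x∈P (twins-exclusive G t op x∈P))
  where
  open TwinLeaves t
  x∉S : x ∉ replace P x l
  x∉S = replace-drops distinct

sameSize-deleteTwin : ∀ {m} (G : Graph (suc m)) {x l} → TwinLeaves G x l →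
                      AllMaxOPSameSize G → AllMaxOPSameSize (deleteVertex G x)
sameSize-deleteTwin G {x} t = sameSize-transfer (deleteVertex G x) G
  (λ P mP → insertAt P x outside , embed-maximal G x t mP , ∣insertAt-outside∣ P x)

sameSize-undeleteTwin : ∀ {m} (G : Graph (suc m)) {x l} → TwinLeaves G x l →
                        AllMaxOPSameSize (deleteVertex G x) → AllMaxOPSameSize G
sameSize-undeleteTwin G {x} t = sameSize-transfer G (deleteVertex G x) (shrink G t)

pendant-twin : ∀ {n} (G : Graph n) {s} → (sup : SupportVertex G s) →
               TwinLeaves (addPendant G s) zero (suc (proj₁ sup))
pendant-twin G {s} (l , sl , leaf) = record
  { support = suc s ; distinct = λ () ; x-adj = refl ; l-adj = symAdj G sl
  ; x-leaf = suc s , refl , pendant-only ; l-leaf = suc s , symAdj G sl , leaf-only }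
  where
  pendant-only : ∀ v → Adj (addPendant G s) zero v → v ≡ suc s
  pendant-only (suc v) refl = refl
  leaf-only : ∀ v → Adj (addPendant G s) (suc l) v → v ≡ suc s
  leaf-only zero    refl = ⊥-elim (irrAdj G sl)
  leaf-only (suc v) lv   = cong suc (leaf-nbrs-equal G leaf lv (symAdj G sl))

strong-support-twin : ∀ {n} (G : Graph n) {s w} → StrongSupportVertex G s → Leaf G w → Adj G s w →
                      Σ (Fin n) λ l → TwinLeaves G w l
strong-support-twin G {w = w} (l₁ , l₂ , l₁≢l₂ , sl₁ , leaf₁ , sl₂ , leaf₂) leaf sw with w ≟ l₁
... | yes refl = l₂ , leaves-twins G sw leaf sl₂ leaf₂ l₁≢l₂
... | no w≢l₁  = l₁ , leaves-twins G sw leaf sl₁ leaf₁ w≢l₁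

mainTheorem2 :
    (∀ (n : ℕ) (G : Graph n) → AllMaxOPSameSize G →
      ∀ (s : Fin n) → SupportVertex G s → AllMaxOPSameSize (addPendant G s))
    ×
    (∀ (m : ℕ) (G : Graph (suc m)) → AllMaxOPSameSize G →
      ∀ (s w : Fin (suc m)) → StrongSupportVertex G s → Leaf G w → Adj G s w →
        AllMaxOPSameSize (deleteVertex G w))
mainTheorem2 = partA , partB
  where
  -- deleteVertex (addPendant G s) zero is G itself.
  partA : ∀ (n : ℕ) (G : Graph n) → AllMaxOPSameSize G →
          ∀ (s : Fin n) → SupportVertex G s → AllMaxOPSameSize (addPendant G s)
  partA n G same s sup = sameSize-undeleteTwin (addPendant G s) (pendant-twin G sup) same
  partB : ∀ (m : ℕ) (G : Graph (suc m)) → AllMaxOPSameSize G →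
          ∀ (s w : Fin (suc m)) → StrongSupportVertex G s → Leaf G w → Adj G s w →
            AllMaxOPSameSize (deleteVertex G w)
  partB m G same s w strong leaf sw with strong-support-twin G strong leaf sw
  ... | _ , t = sameSize-deleteTwin G t same
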